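{- Let $\mathfrak g_c$ be a complex semisimple Lie algebra of rank $\ell$ with root system $\Delta$, a fixed positive system $\Delta_+$ and simple roots $\gamma_1,\dots,\gamma_\ell$, and let $S\subseteq\{1,\dots,\ell\}$. Let $A$ be the Cartan matrix, $\Delta_+^c$ the set of compact positive roots with respect to $S$, and $\xi_1,\dots,\xi_\ell$ the fundamental-weight coordinates of $\varphi_S$ (all as defined in the context). Then for every $i\in S$, $$\xi_i=-4+4\Big(A\sum_{\alpha\in\Delta_+^c}\alpha\Big)_i-2\Big(A\sum_{\alpha\in\mathrm{span}\{\gamma_k\,:\,k\notin S\}\cap\Delta_+}\alpha\Big)_i ,$$ where a sum of roots $\sum_k c_k\gamma_k$ is identified with its coordinate column vector $(c_1,\dots,c_\ell)^T$.
   Context: $(\cdot,\cdot)$ is the positive definite inner product on the real span of the roots induced by the Killing form. The Cartan matrix is $A_{ij}=\frac{2(\gamma_i,\gamma_j)}{(\gamma_i,\gamma_i)}$. Every positive root is written $\alpha=\sum_{k=1}^\ell n_k\gamma_k$ with nonnegative integers $n_k$. Given $S$ (the set of indices of painted nodes of a Vogan diagram, i.e. of non-compact simple roots), a positive root $\alpha=\sum_k n_k\gamma_k$ is called compact if $\sum_{k\in S}n_k$ is even and non-compact otherwise; set $\varepsilon_\alpha=-1$ if $\alpha$ is compact and $\varepsilon_\alpha=1$ otherwise, and let $\Delta_+^c$ be the set of compact positive roots. Define $\eta=-2\sum_{\alpha\in\Delta_+}\varepsilon_\alpha\alpha$ and $\varphi_S=\eta-2\sum_{\alpha\in\mathrm{span}\{\gamma_k\,:\,k\notin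 S\}\cap\Delta_+}\alpha$. Writing $\varphi_S=\sum_k c_k\gamma_k$, the coefficients of $\varphi_S$ in the basis of fundamental dominant weights are $\xi_i=\sum_{k=1}^\ell A_{ik}c_k=\frac{2(\varphi_S,\gamma_i)}{(\gamma_i,\gamma_i)}$. -}

module Defs where

open import Data.Nat as ℕ using (ℕ; zero; suc)
open import Data.Nat.Divisibility using (_∣?_)
open import Data.Integer as ℤ using (ℤ; +_; ∣_∣)
open import Data.Rational as ℚ using (ℚ; 0ℚ; 1ℚ; _+_; _*_; _-_; -_; _<_; 1/_; ≢-nonZero)
open import Data.Rational.Properties as ℚP using ()
open import Data.Fin using (Fin; zero; suc)
open import Data.Fin.Subset using (Subset)
open import Data.Vec as V using (Vec; lookup; tabulate)
open import Data.Vec.Relation.Unary.All as VAll using () renaming (All to VAll)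
open import Data.List using (List; []; _∷_; filter)
open import Data.List.Membership.Propositional using (_∈_)
open import Data.List.Relation.Unary.Unique.Propositional using (Unique)
open import Data.Bool using (Bool; true; false; if_then_else_)
open import Data.Product using (∃; _×_; _,_)
open import Data.Sum using (_⊎_)
open import Relation.Nullary using (¬_; Dec; yes; no; does)
open import Relation.Binary.PropositionalEquality using (_≡_; _≢_)

∑ : ∀ {n} → (Fin n → ℚ) → ℚ
∑ {zero}  f = 0ℚ
∑ {suc n} f = f zero + ∑ (λ i → f (suc i))

toℚ : ℤ → ℚ
toℚ z = z ℚ./ 1

-- total inverse (0 at 0); only ever applied to (γᵢ,γᵢ) > 0
inv : ℚ → ℚ
inv p with p ℚP.≟ 0ℚ
... | yes _ = 0ℚ
... | no ne = 1/_ p {{≢-nonZero ne}}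

co : ∀ {ℓ} → Vec ℤ ℓ → Fin ℓ → ℚ
co α i = toℚ (lookup α i)

-- k-th simple root γ_k as a coordinate vector (the unit vector e_k)
unitVec : ∀ {ℓ} → Fin ℓ → Vec ℤ ℓ
unitVec k = tabulate (λ j → if does (k Data.Fin.≟ j) then + 1 else + 0)
  where import Data.Fin

form : ∀ {ℓ} → (Fin ℓ → Fin ℓ → ℚ) → (Fin ℓ → ℚ) → (Fin ℓ → ℚ) → ℚ
form G u v = ∑ (λ i → ∑ (λ j → u i * G i j * v j))

-- Reduced crystallographic root system of rank ℓ with a chosen base
-- γ₁,…,γ_ℓ (the root system of a complex semisimple Lie algebra of
-- rank ℓ w.r.t. a Cartan subalgebra and positive system). Roots are
-- recorded by their coordinates w.r.t. the simple roots; G is the Gram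
-- matrix of the (Killing-form induced) inner product on the simple roots.

record RootSystem (ℓ : ℕ) : Set where
  field
    G        : Fin ℓ → Fin ℓ → ℚ
    G-sym    : ∀ i j → G i j ≡ G j i
    G-posdef : ∀ (v : Fin ℓ → ℚ) → (∃ λ i → v i ≢ 0ℚ) → 0ℚ < form G v v
    roots    : List (Vec ℤ ℓ)
    roots-unique : Unique roots
    simple∈  : ∀ k → unitVec k ∈ roots
    nonzero  : ∀ {α} → α ∈ roots → α ≢ V.replicate ℓ (+ 0)
    signed   : ∀ {α} → α ∈ roots → VAll (+ 0 ℤ.≤_) α ⊎ VAll (ℤ._≤ + 0) α
    crystallographic : ∀ {α β} → α ∈ roots → β ∈ roots →
      ∃ λ (n : ℤ) → toℚ (+ 2) * form G (co β) (co α) ≡ toℚ n * form G (co α) (co α)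
    -- closed under reflections: s_α β = β - 2(β,α)/(α,α) α is a root
    reflection-closed : ∀ {α β} → α ∈ roots → β ∈ roots →
      ∃ λ γ → γ ∈ roots ×
        (∀ i → form G (co α) (co α) * (co γ i - co β i)
               ≡ - (toℚ (+ 2) * form G (co β) (co α) * co α i))
    reduced  : ∀ {α β} → α ∈ roots → β ∈ roots → ∀ (c : ℚ) →
      (∀ i → co β i ≡ c * co α i) → c ≡ 1ℚ ⊎ c ≡ - 1ℚ

module _ {ℓ : ℕ} (R : RootSystem ℓ) (S : Subset ℓ) where
  open RootSystem R

  A : Fin ℓ → Fin ℓ → ℚ
  A i j = toℚ (+ 2) * G i j * inv (G i i)

  A· : (Fin ℓ → ℚ) → Fin ℓ → ℚ
  A· c i = ∑ (λ k → A i k * c k)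

  isPositive : Vec ℤ ℓ → Set
  isPositive α = VAll (+ 0 ℤ.≤_) α

  Δ₊ : List (Vec ℤ ℓ)
  Δ₊ = filter (λ α → VAll.all? (λ x → + 0 ℤ.≤? x) α) roots

  sumOverS : Vec ℤ ℓ → ℤ
  sumOverS α = go S α
    where
      go : ∀ {m} → Vec Bool m → Vec ℤ m → ℤ
      go V.[] V.[] = + 0
      go (true  V.∷ s) (x V.∷ xs) = x ℤ.+ go s xs
      go (false V.∷ s) (x V.∷ xs) = go s xs

  Compact : Vec ℤ ℓ → Set
  Compact α = 2 Data.Nat.Divisibility.∣ ∣ sumOverS α ∣
    where import Data.Nat.Divisibility

  compact? : (α : Vec ℤ ℓ) → Dec (Compact α)
  compact? α = 2 ∣? ∣ sumOverS α ∣

  Δ₊ᶜ : List (Vec ℤ ℓ)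
  Δ₊ᶜ = filter compact? Δ₊

  ε : Vec ℤ ℓ → ℚ
  ε α = if does (compact? α) then - 1ℚ else 1ℚ

  InSpanComplement : Vec ℤ ℓ → Set
  InSpanComplement α = VAll (λ p → Data.Product.proj₁ p ≡ true → Data.Product.proj₂ p ≡ + 0) (V.zip S α)
    where import Data.Product

  inSpanComplement? : (α : Vec ℤ ℓ) → Dec (InSpanComplement α)
  inSpanComplement? α = VAll.all? dec (V.zip S α)
    where
      dec : (p : Bool × ℤ) → Dec (Data.Product.proj₁ p ≡ true → Data.Product.proj₂ p ≡ + 0)
      dec (false , z) = yes (λ ())
      dec (true , z) with z ℤ.≟ + 0
      ... | yes e = yes (λ _ → e)
      ... | no ne = no (λ f → ne (f _≡_.refl))
      import Data.Product

  Δ₊ˢ : List (Vec ℤ ℓ)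
  Δ₊ˢ = filter inSpanComplement? Δ₊

  wsum : (Vec ℤ ℓ → ℚ) → List (Vec ℤ ℓ) → Fin ℓ → ℚ
  wsum w []       i = 0ℚ
  wsum w (α ∷ αs) i = w α * co α i + wsum w αs i

  rootSum : List (Vec ℤ ℓ) → Fin ℓ → ℚ
  rootSum = wsum (λ _ → 1ℚ)

  η : Fin ℓ → ℚ
  η i = - (toℚ (+ 2) * wsum ε Δ₊ i)

  φ : Fin ℓ → ℚ
  φ i = η i - toℚ (+ 2) * rootSum Δ₊ˢ i

  ξ : Fin ℓ → ℚ
  ξ = A· φ

module Submission where

-- Since ε_α = 1 − 2·[α compact], η = −2·2ρ + 4·Σ_{Δ₊ᶜ} α with 2ρ = Σ_{α∈Δ₊} α, so
-- φ_S = −2·2ρ + 4·Σ_{Δ₊ᶜ} α − 2·Σ_{Δ₊ˢ} α and, A being linear, everything reduces to the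
-- classical identity (A·2ρ)ᵢ = 2, i.e. (2ρ, γᵢ) = (γᵢ, γᵢ). For that, the simple reflection
-- sᵢ α = α − ⟨α, γᵢ^∨⟩ γᵢ permutes Δ₊ ∖ {γᵢ} (a positive root other than γᵢ has a positive
-- coordinate away from i, which sᵢ does not change) and negates (·, γᵢ); hence the roots of
-- Δ₊ ∖ {γᵢ} contribute nothing and only (γᵢ, γᵢ) is left.

open import Defs
open import Algebra.Bundles using (CommutativeMonoid)
open import Data.Bool using (true; false; if_then_else_)
open import Data.Empty using (⊥-elim)
open import Data.Fin using (Fin; zero; suc; _≟_)
open import Data.Fin.Subset using (Subset)
open import Data.Integer as ℤ using (ℤ; +_; -[1+_])
import Data.Integer.Properties as ℤP
open import Data.List using (List; []; _∷_; map; foldr; filter)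
import Data.List.Properties as List
open import Data.List.Membership.Propositional.Properties using (∈-map⁺; ∈-map⁻; ∈-filter⁺; ∈-filter⁻)
open import Data.List.Membership.Propositional.Properties.WithK using (unique∧set⇒bag)
open import Data.List.Relation.Binary.BagAndSetEquality using (∼bag⇒↭)
open import Data.List.Relation.Binary.Permutation.Propositional using (_↭_; ↭⇒↭ₛ)
import Data.List.Relation.Binary.Permutation.Propositional.Properties as ↭
open import Data.List.Relation.Binary.Permutation.Setoid.Properties using (foldr-commMonoid)
open import Data.List.Relation.Unary.All as All using (All)
import Data.List.Relation.Unary.All.Properties as All
open import Data.List.Relation.Unary.Any using (here; there)
open import Data.List.Relation.Unary.Unique.Propositional using (Unique; []; _∷_)
import Data.List.Relation.Unary.Unique.Propositional.Properties as Unique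
open import Data.Nat as ℕ using (ℕ; zero; suc)
import Data.Nat.Coprimality as Coprime
open import Data.Product using (_,_; proj₁; proj₂)
open import Data.Rational as ℚ using (ℚ; 0ℚ; 1ℚ; _+_; _*_; _-_; -_; mkℚ; ↥_; ½)
import Data.Rational.Properties as ℚP
open import Data.Rational.Solver using (module +-*-Solver)
open import Data.Sum using (inj₁; inj₂; [_,_]′)
open import Data.Vec using (Vec; lookup; tabulate)
open import Data.Vec.Properties using (lookup∘tabulate; tabulate∘lookup; tabulate-cong; ≡-dec)
open import Data.Vec.Relation.Unary.All using () renaming (All to VAll)
import Data.Vec.Relation.Unary.All as VAll
import Data.Vec.Relation.Unary.All.Properties as VAll
open import Function using (id)
open import Function.Bundles using (_⇔_; mk⇔)
open import Relation.Binary.Definitions using (DecidableEquality)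
open import Relation.Binary.PropositionalEquality
  using (_≡_; _≢_; refl; sym; trans; cong; cong₂; subst; subst₂; module ≡-Reasoning)
open import Relation.Nullary using (¬_; ¬?; Dec; does; yes; no)
open import Relation.Nullary.Decidable using (dec-true; dec-false)

open +-*-Solver

∑-cong : ∀ {n} {f h : Fin n → ℚ} → (∀ a → f a ≡ h a) → ∑ f ≡ ∑ h
∑-cong {zero}  f≡h = refl
∑-cong {suc n} f≡h = cong₂ _+_ (f≡h zero) (∑-cong (λ a → f≡h (suc a)))

∑-+ : ∀ {n} (f h : Fin n → ℚ) → ∑ (λ a → f a + h a) ≡ ∑ f + ∑ h
∑-+ {zero}  f h = refl
∑-+ {suc n} f h = begin
  (f zero + h zero) + ∑ (λ a → f (suc a) + h (suc a))
    ≡⟨ cong (λ s → (f zero + h zero) + s) (∑-+ (λ a → f (suc a)) (λ a → h (suc a))) ⟩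
  (f zero + h zero) + (∑ (λ a → f (suc a)) + ∑ (λ a → h (suc a)))
    ≡⟨ solve 4 (λ x y u v → (x :+ y) :+ (u :+ v) := (x :+ u) :+ (y :+ v))
               refl (f zero) (h zero) (∑ (λ a → f (suc a))) (∑ (λ a → h (suc a))) ⟩
  ∑ f + ∑ h ∎
  where open ≡-Reasoning

∑-*ˡ : ∀ {n} (q : ℚ) (f : Fin n → ℚ) → ∑ (λ a → q * f a) ≡ q * ∑ f
∑-*ˡ {zero}  q f = sym (ℚP.*-zeroʳ q)
∑-*ˡ {suc n} q f = trans (cong (λ s → q * f zero + s) (∑-*ˡ q (λ a → f (suc a))))
                         (sym (ℚP.*-distribˡ-+ q (f zero) (∑ (λ a → f (suc a)))))

∑-linear : ∀ {n} (p q : ℚ) (f h : Fin n → ℚ) → ∑ (λ a → p * f a + q * h a) ≡ p * ∑ f + q * ∑ h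
∑-linear p q f h = trans (∑-+ (λ a → p * f a) (λ a → q * h a)) (cong₂ _+_ (∑-*ˡ p f) (∑-*ˡ q h))

∑-unitVec : ∀ {n} (i : Fin n) (f : Fin n → ℚ) → ∑ (λ a → co (unitVec i) a * f a) ≡ f i
∑-unitVec zero    f = begin
  1ℚ * f zero + ∑ (λ a → co (unitVec {suc _} zero) (suc a) * f (suc a))
    ≡⟨ cong (λ s → 1ℚ * f zero + s) (∑-cong (λ a → cong (λ z → toℚ z * f (suc a)) (lookup∘tabulate _ a))) ⟩
  1ℚ * f zero + ∑ (λ a → 0ℚ * f (suc a))
    ≡⟨ cong (λ s → 1ℚ * f zero + s) (∑-*ˡ 0ℚ (λ a → f (suc a))) ⟩
  1ℚ * f zero + 0ℚ * ∑ (λ a → f (suc a))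
    ≡⟨ solve 2 (λ x s → con 1ℚ :* x :+ con 0ℚ :* s := x) refl (f zero) (∑ (λ a → f (suc a))) ⟩
  f zero ∎
  where open ≡-Reasoning
∑-unitVec (suc i) f = trans (cong (_+ ∑ (λ a → co (unitVec i) a * f (suc a))) (ℚP.*-zeroˡ (f zero)))
                            (trans (ℚP.+-identityˡ _) (∑-unitVec i (λ a → f (suc a))))

∑-unitVecʳ : ∀ {n} (i : Fin n) (f : Fin n → ℚ) → ∑ (λ a → f a * co (unitVec i) a) ≡ f i
∑-unitVecʳ i f = trans (∑-cong (λ a → ℚP.*-comm (f a) (co (unitVec i) a))) (∑-unitVec i f)

toℚ-mkℚ : ∀ z → toℚ z ≡ mkℚ z 0 (Coprime.sym (Coprime.1-coprimeTo _))
toℚ-mkℚ (+ n)    = ℚP.normalize-coprime (Coprime.sym (Coprime.1-coprimeTo _))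
toℚ-mkℚ -[1+ n ] = cong -_ (ℚP.normalize-coprime {suc n} {0} (Coprime.sym (Coprime.1-coprimeTo _)))

↥-toℚ : ∀ z → ↥ toℚ z ≡ z
↥-toℚ z rewrite toℚ-mkℚ z = refl

toℚ-injective : ∀ {a b} → toℚ a ≡ toℚ b → a ≡ b
toℚ-injective {a} {b} eq = trans (sym (↥-toℚ a)) (trans (cong ↥_ eq) (↥-toℚ b))

toℚ-homo‿- : ∀ z → toℚ (ℤ.- z) ≡ - toℚ z
toℚ-homo‿- (+ zero)  = refl
toℚ-homo‿- (+ suc n) = refl
toℚ-homo‿- -[1+ n ]  = trans (toℚ-mkℚ (+ suc n)) (cong (λ q → - (- q)) (sym (toℚ-mkℚ (+ suc n))))

toℚ-homo-+ : ∀ a b → toℚ (a ℤ.+ b) ≡ toℚ a + toℚ b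
toℚ-homo-+ a b rewrite toℚ-mkℚ a | toℚ-mkℚ b =
  cong₂ (λ x y → (x ℤ.+ y) ℚ./ 1) (sym (ℤP.*-identityʳ a)) (sym (ℤP.*-identityʳ b))

toℚ-homo-minus : ∀ a b → toℚ (a ℤ.- b) ≡ toℚ a - toℚ b
toℚ-homo-minus a b = trans (toℚ-homo-+ a (ℤ.- b)) (cong (λ s → toℚ a + s) (toℚ-homo‿- b))

toℚ-homo-* : ∀ a b → toℚ (a ℤ.* b) ≡ toℚ a * toℚ b
toℚ-homo-* a b rewrite toℚ-mkℚ a | toℚ-mkℚ b = refl

≡-neg⇒≡0 : ∀ {q} → q ≡ - q → q ≡ 0ℚ
≡-neg⇒≡0 {q} q≡-q = begin
  q              ≡⟨ solve 1 (λ x → x := (x :+ x) :* con ½) refl q ⟩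
  (q + q) * ½    ≡⟨ cong (λ r → (q + r) * ½) q≡-q ⟩
  (q + - q) * ½  ≡⟨ cong (_* ½) (ℚP.+-inverseʳ q) ⟩
  0ℚ * ½         ≡⟨ ℚP.*-zeroˡ ½ ⟩
  0ℚ             ∎
  where open ≡-Reasoning

sumℚ : List ℚ → ℚ
sumℚ = foldr _+_ 0ℚ

sumℚ-↭ : ∀ {xs ys} → xs ↭ ys → sumℚ xs ≡ sumℚ ys
sumℚ-↭ xs↭ys = foldr-commMonoid setoid isCommutativeMonoid (↭⇒↭ₛ xs↭ys)
  where open CommutativeMonoid ℚP.+-0-commutativeMonoid

sumℚ-neg : ∀ xs → sumℚ (map -_ xs) ≡ - sumℚ xs
sumℚ-neg []       = refl
sumℚ-neg (x ∷ xs) = trans (cong (λ s → - x + s) (sumℚ-neg xs)) (sym (ℚP.neg-distrib-+ x (sumℚ xs)))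

module _ {A : Set} where
  open import Data.List.Membership.Propositional using (_∈_)

  unique∧set⇒↭ : ∀ {xs ys : List A} → Unique xs → Unique ys → (∀ {z} → z ∈ xs ⇔ z ∈ ys) → xs ↭ ys
  unique∧set⇒↭ xs! ys! xs≈ys = ∼bag⇒↭ (unique∧set⇒bag xs! ys! xs≈ys)

  map⁺-injectiveOn : ∀ {f : A → A} {xs} → (∀ {x y} → x ∈ xs → y ∈ xs → f x ≡ f y → x ≡ y) →
                     Unique xs → Unique (map f xs)
  map⁺-injectiveOn inj []           = []
  map⁺-injectiveOn inj (x∉xs ∷ xs!) =
    All.map⁺ (All.tabulate (λ y∈xs fx≡fy → All.lookup x∉xs y∈xs (inj (here refl) (there y∈xs) fx≡fy)))
    ∷ map⁺-injectiveOn (λ x∈ y∈ → inj (there x∈) (there y∈)) xs!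

  sumℚ-antiInvariant≡0 : ∀ (f : A → ℚ) (σ : A → A) {xs} → Unique xs →
                         (∀ {x} → x ∈ xs → σ x ∈ xs) →
                         (∀ {x} → x ∈ xs → σ (σ x) ≡ x) →
                         (∀ {x} → x ∈ xs → f (σ x) ≡ - f x) →
                         sumℚ (map f xs) ≡ 0ℚ
  sumℚ-antiInvariant≡0 f σ {xs} xs! σ-closed σ-involutive f-anti = ≡-neg⇒≡0 (begin
    sumℚ (map f xs)                ≡⟨ sumℚ-↭ (↭.map⁺ f (unique∧set⇒↭ xs! σxs! (mk⇔ to from))) ⟩
    sumℚ (map f (map σ xs))        ≡⟨ cong sumℚ (sym (List.map-∘ xs)) ⟩
    sumℚ (map (λ x → f (σ x)) xs)  ≡⟨ cong sumℚ (List.map-cong-local (All.tabulate f-anti)) ⟩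
    sumℚ (map (λ x → - f x) xs)    ≡⟨ cong sumℚ (List.map-∘ xs) ⟩
    sumℚ (map -_ (map f xs))       ≡⟨ sumℚ-neg (map f xs) ⟩
    - sumℚ (map f xs)              ∎)
    where
      open ≡-Reasoning
      σxs! : Unique (map σ xs)
      σxs! = map⁺-injectiveOn
        (λ x∈ y∈ σx≡σy → trans (sym (σ-involutive x∈)) (trans (cong σ σx≡σy) (σ-involutive y∈))) xs!
      to : ∀ {z} → z ∈ xs → z ∈ map σ xs
      to z∈ = subst (_∈ map σ xs) (σ-involutive z∈) (∈-map⁺ σ (σ-closed z∈))
      from : ∀ {z} → z ∈ map σ xs → z ∈ xs
      from z∈ with ∈-map⁻ σ z∈
      ... | _ , x∈ , refl = σ-closed x∈

  sumℚ-remove : (_≟ₐ_ : DecidableEquality A) (f : A → ℚ) {x : A} {xs : List A} → Unique xs → x ∈ xs →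
                sumℚ (map f xs) ≡ f x + sumℚ (map f (filter (λ y → ¬? (y ≟ₐ x)) xs))
  sumℚ-remove _≟ₐ_ f {x} {xs} xs! x∈xs =
    sumℚ-↭ (↭.map⁺ f (unique∧set⇒↭ xs! (x∉rest ∷ Unique.filter⁺ keep? {xs} xs!) (mk⇔ to from)))
    where
      keep? : (y : A) → Dec (y ≢ x)
      keep? y = ¬? (y ≟ₐ x)
      x∉rest : All (x ≢_) (filter keep? xs)
      x∉rest = All.tabulate (λ y∈ x≡y → proj₂ (∈-filter⁻ keep? {xs = xs} y∈) (sym x≡y))
      to : ∀ {z} → z ∈ xs → z ∈ x ∷ filter keep? xs
      to {z} z∈ with z ≟ₐ x
      ... | yes refl = here refl
      ... | no z≢x   = there (∈-filter⁺ keep? z∈ z≢x)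
      from : ∀ {z} → z ∈ x ∷ filter keep? xs → z ∈ xs
      from (here refl) = x∈xs
      from (there z∈)  = proj₁ (∈-filter⁻ keep? z∈)

+0≰-1 : ¬ (+ 0 ℤ.≤ -[1+ 0 ])
+0≰-1 ()

NonNegative : ∀ {n} → Vec ℤ n → Set
NonNegative = VAll (+ 0 ℤ.≤_)

lookup-ext : ∀ {n} {u v : Vec ℤ n} → (∀ j → lookup u j ≡ lookup v j) → u ≡ v
lookup-ext {u = u} {v} eq = trans (sym (tabulate∘lookup u)) (trans (tabulate-cong eq) (tabulate∘lookup v))

module _ {n : ℕ} (i : Fin n) where

  unitVec-nonNegative : NonNegative (unitVec i)
  unitVec-nonNegative = VAll.tabulate⁺ (λ j → bit≥0 (does (i ≟ j)))
    where
      bit≥0 : ∀ b → + 0 ℤ.≤ (if b then + 1 else + 0)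
      bit≥0 true  = ℤ.+≤+ ℕ.z≤n
      bit≥0 false = ℤ.+≤+ ℕ.z≤n

  lookup-unitVec-self : lookup (unitVec i) i ≡ + 1
  lookup-unitVec-self = trans (lookup∘tabulate _ i) (cong (λ b → if b then + 1 else + 0) (dec-true (i ≟ i) refl))

  lookup-unitVec-other : ∀ {j} → j ≢ i → lookup (unitVec i) j ≡ + 0
  lookup-unitVec-other {j} j≢i =
    trans (lookup∘tabulate _ j) (cong (λ b → if b then + 1 else + 0) (dec-false (i ≟ j) (λ i≡j → j≢i (sym i≡j))))

module SimpleReflection {ℓ : ℕ} (R : RootSystem ℓ) (i : Fin ℓ) where
  open RootSystem R
  open import Data.List.Membership.Propositional using (_∈_)

  eᵢ : Vec ℤ ℓ
  eᵢ = unitVec i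

  ‖γᵢ‖² : ℚ
  ‖γᵢ‖² = G i i

  ⟨_,γᵢ⟩ : (Fin ℓ → ℚ) → ℚ
  ⟨ c ,γᵢ⟩ = ∑ (λ a → c a * G a i)

  ⟨,γᵢ⟩-cong : ∀ {u v} → (∀ a → u a ≡ v a) → ⟨ u ,γᵢ⟩ ≡ ⟨ v ,γᵢ⟩
  ⟨,γᵢ⟩-cong u≡v = ∑-cong (λ a → cong (_* G a i) (u≡v a))

  ⟨,γᵢ⟩-linear : ∀ p q u v → ⟨ (λ a → p * u a + q * v a) ,γᵢ⟩ ≡ p * ⟨ u ,γᵢ⟩ + q * ⟨ v ,γᵢ⟩
  ⟨,γᵢ⟩-linear p q u v = trans
    (∑-cong (λ a → solve 5 (λ p q x y g → (p :* x :+ q :* y) :* g := p :* (x :* g) :+ q :* (y :* g))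
                           refl p q (u a) (v a) (G a i)))
    (∑-linear p q (λ a → u a * G a i) (λ a → v a * G a i))

  form-eᵢ : ∀ u → form G u (co eᵢ) ≡ ⟨ u ,γᵢ⟩
  form-eᵢ u = ∑-cong (λ a → ∑-unitVecʳ i (λ b → u a * G a b))

  ⟨eᵢ,γᵢ⟩ : ⟨ co eᵢ ,γᵢ⟩ ≡ ‖γᵢ‖²
  ⟨eᵢ,γᵢ⟩ = ∑-unitVec i (λ a → G a i)

  ‖γᵢ‖²-positive : 0ℚ ℚ.< ‖γᵢ‖²
  ‖γᵢ‖²-positive = subst (0ℚ ℚ.<_) (trans (form-eᵢ (co eᵢ)) ⟨eᵢ,γᵢ⟩)
    (G-posdef (co eᵢ) (i , λ eᵢᵢ≡0 → 1≢0 (trans (sym (cong toℚ (lookup-unitVec-self i))) eᵢᵢ≡0)))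
    where
      1≢0 : 1ℚ ≢ 0ℚ
      1≢0 ()

  ‖γᵢ‖²-inverseʳ : ‖γᵢ‖² * inv ‖γᵢ‖² ≡ 1ℚ
  ‖γᵢ‖²-inverseʳ with ‖γᵢ‖² ℚP.≟ 0ℚ
  ... | yes ‖γᵢ‖²≡0 = ⊥-elim (ℚP.<-irrefl (sym ‖γᵢ‖²≡0) ‖γᵢ‖²-positive)
  ... | no  ‖γᵢ‖²≢0 = ℚP.*-inverseʳ ‖γᵢ‖² {{ℚ.≢-nonZero ‖γᵢ‖²≢0}}

  ‖γᵢ‖²-inverseˡ : inv ‖γᵢ‖² * ‖γᵢ‖² ≡ 1ℚ
  ‖γᵢ‖²-inverseˡ = trans (ℚP.*-comm (inv ‖γᵢ‖²) ‖γᵢ‖²) ‖γᵢ‖²-inverseʳ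

  ‖γᵢ‖²-*-cancelˡ : ∀ {x y} → ‖γᵢ‖² * x ≡ ‖γᵢ‖² * y → x ≡ y
  ‖γᵢ‖²-*-cancelˡ {x} {y} eq = trans (sym (undo x)) (trans (cong (inv ‖γᵢ‖² *_) eq) (undo y))
    where
      undo : ∀ z → inv ‖γᵢ‖² * (‖γᵢ‖² * z) ≡ z
      undo z = trans (sym (ℚP.*-assoc (inv ‖γᵢ‖²) ‖γᵢ‖² z))
                     (trans (cong (_* z) ‖γᵢ‖²-inverseˡ) (ℚP.*-identityˡ z))

  *-‖γᵢ‖²-*-inv : ∀ p → p * ‖γᵢ‖² * inv ‖γᵢ‖² ≡ p
  *-‖γᵢ‖²-*-inv p = trans (ℚP.*-assoc p ‖γᵢ‖² (inv ‖γᵢ‖²))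
                            (trans (cong (p *_) ‖γᵢ‖²-inverseʳ) (ℚP.*-identityʳ p))

  *-inv-*-‖γᵢ‖² : ∀ p → p * inv ‖γᵢ‖² * ‖γᵢ‖² ≡ p
  *-inv-*-‖γᵢ‖² p = trans (ℚP.*-assoc p (inv ‖γᵢ‖²) ‖γᵢ‖²)
                             (trans (cong (p *_) ‖γᵢ‖²-inverseˡ) (ℚP.*-identityʳ p))

  -- The numerator ↥ is a junk value off the roots; on roots the quotient is an integer
  -- by crystallographicity (toℚ-cartanInteger).
  cartanInteger : Vec ℤ ℓ → ℤ
  cartanInteger α = ↥ (toℚ (+ 2) * ⟨ co α ,γᵢ⟩ * inv ‖γᵢ‖²)

  reflect : Vec ℤ ℓ → Vec ℤ ℓ
  reflect α = tabulate (λ j → lookup α j ℤ.- cartanInteger α ℤ.* lookup eᵢ j)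

  co-reflect : ∀ α j → co (reflect α) j ≡ co α j - toℚ (cartanInteger α) * co eᵢ j
  co-reflect α j = begin
    toℚ (lookup (reflect α) j)                             ≡⟨ cong toℚ (lookup∘tabulate _ j) ⟩
    toℚ (lookup α j ℤ.- cartanInteger α ℤ.* lookup eᵢ j)   ≡⟨ toℚ-homo-minus (lookup α j) _ ⟩
    co α j - toℚ (cartanInteger α ℤ.* lookup eᵢ j)         ≡⟨ cong (λ x → co α j - x) (toℚ-homo-* (cartanInteger α) _) ⟩
    co α j - toℚ (cartanInteger α) * co eᵢ j               ∎
    where open ≡-Reasoning

  lookup-reflect-other : ∀ α {j} → j ≢ i → lookup (reflect α) j ≡ lookup α j
  lookup-reflect-other α {j} j≢i = begin
    lookup (reflect α) j                            ≡⟨ lookup∘tabulate _ j ⟩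
    lookup α j ℤ.- cartanInteger α ℤ.* lookup eᵢ j  ≡⟨ cong (λ e → lookup α j ℤ.- cartanInteger α ℤ.* e)
                                                           (lookup-unitVec-other i j≢i) ⟩
    lookup α j ℤ.- cartanInteger α ℤ.* + 0          ≡⟨ cong (λ x → lookup α j ℤ.- x)
                                                           (ℤP.*-zeroʳ (cartanInteger α)) ⟩
    lookup α j ℤ.+ + 0                              ≡⟨ ℤP.+-identityʳ (lookup α j) ⟩
    lookup α j                                      ∎
    where open ≡-Reasoning

  cartanInteger-eᵢ : cartanInteger eᵢ ≡ + 2
  cartanInteger-eᵢ = trans (cong (λ x → ↥ (toℚ (+ 2) * x * inv ‖γᵢ‖²)) ⟨eᵢ,γᵢ⟩)
                           (trans (cong ↥_ (*-‖γᵢ‖²-*-inv (toℚ (+ 2)))) (↥-toℚ (+ 2)))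

  lookup-reflect-eᵢ : lookup (reflect eᵢ) i ≡ -[1+ 0 ]
  lookup-reflect-eᵢ = trans (lookup∘tabulate _ i)
    (cong₂ (λ e m → e ℤ.- m ℤ.* e) (lookup-unitVec-self i) cartanInteger-eᵢ)

  module _ {α : Vec ℤ ℓ} (α∈ : α ∈ roots) where

    toℚ-cartanInteger : toℚ (cartanInteger α) ≡ toℚ (+ 2) * ⟨ co α ,γᵢ⟩ * inv ‖γᵢ‖²
    toℚ-cartanInteger with crystallographic (simple∈ i) α∈
    ... | n , 2⟨α,eᵢ⟩≡n‖eᵢ‖² = trans (cong (λ q → toℚ (↥ q)) quotient≡n)
                                     (trans (cong toℚ (↥-toℚ n)) (sym quotient≡n))
      where
        quotient≡n : toℚ (+ 2) * ⟨ co α ,γᵢ⟩ * inv ‖γᵢ‖² ≡ toℚ n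
        quotient≡n = trans (cong (_* inv ‖γᵢ‖²) (subst₂ (λ a b → toℚ (+ 2) * a ≡ toℚ n * b)
                             (form-eᵢ (co α)) (trans (form-eᵢ (co eᵢ)) ⟨eᵢ,γᵢ⟩) 2⟨α,eᵢ⟩≡n‖eᵢ‖²))
                           (*-‖γᵢ‖²-*-inv (toℚ n))

    cartanInteger-scaled : toℚ (cartanInteger α) * ‖γᵢ‖² ≡ toℚ (+ 2) * ⟨ co α ,γᵢ⟩
    cartanInteger-scaled = trans (cong (_* ‖γᵢ‖²) toℚ-cartanInteger)
                                 (*-inv-*-‖γᵢ‖² (toℚ (+ 2) * ⟨ co α ,γᵢ⟩))

    ⟨reflect,γᵢ⟩ : ⟨ co (reflect α) ,γᵢ⟩ ≡ - ⟨ co α ,γᵢ⟩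
    ⟨reflect,γᵢ⟩ = begin
      ⟨ co (reflect α) ,γᵢ⟩
        ≡⟨ ⟨,γᵢ⟩-cong (λ j → trans (co-reflect α j)
             (solve 3 (λ x m e → x :- m :* e := con 1ℚ :* x :+ (:- m) :* e) refl (co α j) m (co eᵢ j))) ⟩
      ⟨ (λ j → 1ℚ * co α j + (- m) * co eᵢ j) ,γᵢ⟩
        ≡⟨ ⟨,γᵢ⟩-linear 1ℚ (- m) (co α) (co eᵢ) ⟩
      1ℚ * ⟨ co α ,γᵢ⟩ + (- m) * ⟨ co eᵢ ,γᵢ⟩
        ≡⟨ cong (λ x → 1ℚ * ⟨ co α ,γᵢ⟩ + (- m) * x) ⟨eᵢ,γᵢ⟩ ⟩
      1ℚ * ⟨ co α ,γᵢ⟩ + (- m) * ‖γᵢ‖²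
        ≡⟨ solve 3 (λ x m g → con 1ℚ :* x :+ (:- m) :* g := x :- m :* g) refl ⟨ co α ,γᵢ⟩ m ‖γᵢ‖² ⟩
      ⟨ co α ,γᵢ⟩ - m * ‖γᵢ‖²
        ≡⟨ cong (λ x → ⟨ co α ,γᵢ⟩ - x) cartanInteger-scaled ⟩
      ⟨ co α ,γᵢ⟩ - toℚ (+ 2) * ⟨ co α ,γᵢ⟩
        ≡⟨ solve 1 (λ x → x :- (con 1ℚ :+ con 1ℚ) :* x := :- x) refl ⟨ co α ,γᵢ⟩ ⟩
      - ⟨ co α ,γᵢ⟩ ∎
      where
        open ≡-Reasoning
        m : ℚ
        m = toℚ (cartanInteger α)

    cartanInteger-reflect : cartanInteger (reflect α) ≡ ℤ.- cartanInteger α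
    cartanInteger-reflect = begin
      ↥ (toℚ (+ 2) * ⟨ co (reflect α) ,γᵢ⟩ * inv ‖γᵢ‖²)
        ≡⟨ cong (λ x → ↥ (toℚ (+ 2) * x * inv ‖γᵢ‖²)) ⟨reflect,γᵢ⟩ ⟩
      ↥ (toℚ (+ 2) * (- ⟨ co α ,γᵢ⟩) * inv ‖γᵢ‖²)
        ≡⟨ cong ↥_ (solve 3 (λ t x κ → t :* (:- x) :* κ := :- (t :* x :* κ))
                            refl (toℚ (+ 2)) ⟨ co α ,γᵢ⟩ (inv ‖γᵢ‖²)) ⟩
      ↥ (- (toℚ (+ 2) * ⟨ co α ,γᵢ⟩ * inv ‖γᵢ‖²))
        ≡⟨ cong (λ x → ↥ (- x)) (sym toℚ-cartanInteger) ⟩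
      ↥ (- toℚ (cartanInteger α))
        ≡⟨ cong ↥_ (sym (toℚ-homo‿- (cartanInteger α))) ⟩
      ↥ toℚ (ℤ.- cartanInteger α)
        ≡⟨ ↥-toℚ (ℤ.- cartanInteger α) ⟩
      ℤ.- cartanInteger α ∎
      where open ≡-Reasoning

    reflect-involutive : reflect (reflect α) ≡ α
    reflect-involutive = lookup-ext λ j → toℚ-injective (begin
      co (reflect (reflect α)) j
        ≡⟨ co-reflect (reflect α) j ⟩
      co (reflect α) j - toℚ (cartanInteger (reflect α)) * co eᵢ j
        ≡⟨ cong₂ (λ a m → a - m * co eᵢ j) (co-reflect α j)
                 (trans (cong toℚ cartanInteger-reflect) (toℚ-homo‿- (cartanInteger α))) ⟩
      (co α j - toℚ (cartanInteger α) * co eᵢ j) - (- toℚ (cartanInteger α)) * co eᵢ j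
        ≡⟨ solve 3 (λ a m e → (a :- m :* e) :- (:- m) :* e := a)
                   refl (co α j) (toℚ (cartanInteger α)) (co eᵢ j) ⟩
      co α j ∎)
      where open ≡-Reasoning

    reflect-root : reflect α ∈ roots
    reflect-root with reflection-closed (simple∈ i) α∈
    ... | β , β∈ , reflection-formula = subst (_∈ roots) (lookup-ext (λ j → toℚ-injective (coβ≡ j))) β∈
      where
        open ≡-Reasoning
        m : ℚ
        m = toℚ (cartanInteger α)
        scaled : ∀ j → ‖γᵢ‖² * (co β j - co α j) ≡ ‖γᵢ‖² * (- (m * co eᵢ j))
        scaled j = begin
          ‖γᵢ‖² * (co β j - co α j)
            ≡⟨ cong (_* (co β j - co α j)) (sym (trans (form-eᵢ (co eᵢ)) ⟨eᵢ,γᵢ⟩)) ⟩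
          form G (co eᵢ) (co eᵢ) * (co β j - co α j)
            ≡⟨ reflection-formula j ⟩
          - (toℚ (+ 2) * form G (co α) (co eᵢ) * co eᵢ j)
            ≡⟨ cong (λ x → - (toℚ (+ 2) * x * co eᵢ j)) (form-eᵢ (co α)) ⟩
          - (toℚ (+ 2) * ⟨ co α ,γᵢ⟩ * co eᵢ j)
            ≡⟨ cong (λ x → - (x * co eᵢ j)) (sym cartanInteger-scaled) ⟩
          - (m * ‖γᵢ‖² * co eᵢ j)
            ≡⟨ solve 3 (λ m g e → :- (m :* g :* e) := g :* (:- (m :* e))) refl m ‖γᵢ‖² (co eᵢ j) ⟩
          ‖γᵢ‖² * (- (m * co eᵢ j)) ∎
        coβ≡ : ∀ j → co β j ≡ co (reflect α) j
        coβ≡ j = begin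
          co β j                          ≡⟨ solve 2 (λ b a → b := (b :- a) :+ a) refl (co β j) (co α j) ⟩
          (co β j - co α j) + co α j      ≡⟨ cong (_+ co α j) (‖γᵢ‖²-*-cancelˡ (scaled j)) ⟩
          - (m * co eᵢ j) + co α j        ≡⟨ solve 3 (λ m e a → (:- (m :* e)) :+ a := a :- m :* e)
                                                       refl m (co eᵢ j) (co α j) ⟩
          co α j - m * co eᵢ j            ≡⟨ sym (co-reflect α j) ⟩
          co (reflect α) j                ∎

    module _ (α≥0 : NonNegative α) where

      vanishingOff-i⇒≡eᵢ : (∀ {j} → j ≢ i → lookup α j ≡ + 0) → α ≡ eᵢ
      vanishingOff-i⇒≡eᵢ α≡0-off-i with reduced (simple∈ i) α∈ (co α i) multiple
        where
          multiple : ∀ j → co α j ≡ co α i * co eᵢ j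
          multiple j with j ≟ i
          ... | yes refl =
            sym (trans (cong (λ e → co α j * toℚ e) (lookup-unitVec-self i)) (ℚP.*-identityʳ (co α j)))
          ... | no j≢i   = trans (cong toℚ (α≡0-off-i j≢i))
            (sym (trans (cong (λ e → co α i * toℚ e) (lookup-unitVec-other i j≢i)) (ℚP.*-zeroʳ (co α i))))
      ... | inj₁ αᵢ≡1 = lookup-ext agree
        where
          agree : ∀ j → lookup α j ≡ lookup eᵢ j
          agree j with j ≟ i
          ... | yes refl = trans (toℚ-injective αᵢ≡1) (sym (lookup-unitVec-self i))
          ... | no j≢i   = trans (α≡0-off-i j≢i) (sym (lookup-unitVec-other i j≢i))
      ... | inj₂ αᵢ≡-1 =
        ⊥-elim (+0≰-1 (subst (+ 0 ℤ.≤_) (toℚ-injective {b = -[1+ 0 ]} αᵢ≡-1) (VAll.lookup⁺ α≥0 i)))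

      reflect-nonNegative : α ≢ eᵢ → NonNegative (reflect α)
      reflect-nonNegative α≢eᵢ = [ id , (λ σα≤0 → ⊥-elim (α≢eᵢ (vanishingOff-i⇒≡eᵢ (λ {j} j≢i →
        ℤP.≤-antisym (subst (ℤ._≤ + 0) (lookup-reflect-other α j≢i) (VAll.lookup⁺ σα≤0 j))
                     (VAll.lookup⁺ α≥0 j))))) ]′ (signed reflect-root)

      reflect-≢eᵢ : reflect α ≢ eᵢ
      reflect-≢eᵢ σα≡eᵢ = +0≰-1 (subst (+ 0 ℤ.≤_) αᵢ≡-1 (VAll.lookup⁺ α≥0 i))
        where
          αᵢ≡-1 : lookup α i ≡ -[1+ 0 ]
          αᵢ≡-1 = trans (cong (λ v → lookup v i) (trans (sym reflect-involutive) (cong reflect σα≡eᵢ)))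
                        lookup-reflect-eᵢ

module _ {ℓ : ℕ} (R : RootSystem ℓ) (S : Subset ℓ) where
  open RootSystem R
  open import Data.List.Membership.Propositional using (_∈_)

  A·-cong : ∀ {u v} → (∀ k → u k ≡ v k) → ∀ j → A· R S u j ≡ A· R S v j
  A·-cong u≡v j = ∑-cong (λ k → cong (A R S j k *_) (u≡v k))

  A·-linear₃ : ∀ p q r u v w j →
               A· R S (λ k → p * u k + q * v k + r * w k) j ≡ p * A· R S u j + q * A· R S v j + r * A· R S w j
  A·-linear₃ p q r u v w j = begin
    ∑ (λ k → a k * (p * u k + q * v k + r * w k))
      ≡⟨ ∑-cong (λ k → solve 7 (λ a p q r x y z → a :* (p :* x :+ q :* y :+ r :* z)
                                  := (p :* (a :* x) :+ q :* (a :* y)) :+ r :* (a :* z))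
                              refl (a k) p q r (u k) (v k) (w k)) ⟩
    ∑ (λ k → (p * (a k * u k) + q * (a k * v k)) + r * (a k * w k))
      ≡⟨ ∑-+ (λ k → p * (a k * u k) + q * (a k * v k)) (λ k → r * (a k * w k)) ⟩
    ∑ (λ k → p * (a k * u k) + q * (a k * v k)) + ∑ (λ k → r * (a k * w k))
      ≡⟨ cong₂ _+_ (∑-linear p q (λ k → a k * u k) (λ k → a k * v k)) (∑-*ˡ r (λ k → a k * w k)) ⟩
    p * A· R S u j + q * A· R S v j + r * A· R S w j ∎
    where
      open ≡-Reasoning
      a : Fin ℓ → ℚ
      a = A R S j

  ε-compact : ∀ {α} → Compact R S α → ε R S α ≡ - 1ℚ
  ε-compact {α} c = cong (λ b → if b then - 1ℚ else 1ℚ) (dec-true (compact? R S α) c)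

  ε-noncompact : ∀ {α} → ¬ Compact R S α → ε R S α ≡ 1ℚ
  ε-noncompact {α} ¬c = cong (λ b → if b then - 1ℚ else 1ℚ) (dec-false (compact? R S α) ¬c)

  wsum-ε : ∀ xs k →
           wsum R S (ε R S) xs k ≡ rootSum R S xs k - toℚ (+ 2) * rootSum R S (filter (compact? R S) xs) k
  wsum-ε []       k = refl
  wsum-ε (α ∷ xs) k = byCompactness (compact? R S α)
    where
      open ≡-Reasoning
      s sᶜ : ℚ
      s  = rootSum R S xs k
      sᶜ = rootSum R S (filter (compact? R S) xs) k
      byCompactness : Dec (Compact R S α) →
        ε R S α * co α k + wsum R S (ε R S) xs k
          ≡ (1ℚ * co α k + s) - toℚ (+ 2) * rootSum R S (filter (compact? R S) (α ∷ xs)) k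
      byCompactness (yes c) = begin
        ε R S α * co α k + wsum R S (ε R S) xs k
          ≡⟨ cong₂ (λ e w → e * co α k + w) (ε-compact c) (wsum-ε xs k) ⟩
        - 1ℚ * co α k + (s - toℚ (+ 2) * sᶜ)
          ≡⟨ solve 3 (λ x s c → (:- con 1ℚ) :* x :+ (s :- (con 1ℚ :+ con 1ℚ) :* c)
                               := (con 1ℚ :* x :+ s) :- (con 1ℚ :+ con 1ℚ) :* (con 1ℚ :* x :+ c))
                     refl (co α k) s sᶜ ⟩
        (1ℚ * co α k + s) - toℚ (+ 2) * (1ℚ * co α k + sᶜ)
          ≡⟨ cong (λ ys → (1ℚ * co α k + s) - toℚ (+ 2) * rootSum R S ys k)
                  (sym (List.filter-accept (compact? R S) c)) ⟩
        (1ℚ * co α k + s) - toℚ (+ 2) * rootSum R S (filter (compact? R S) (α ∷ xs)) k ∎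
      byCompactness (no ¬c) = begin
        ε R S α * co α k + wsum R S (ε R S) xs k
          ≡⟨ cong₂ (λ e w → e * co α k + w) (ε-noncompact ¬c) (wsum-ε xs k) ⟩
        1ℚ * co α k + (s - toℚ (+ 2) * sᶜ)
          ≡⟨ solve 3 (λ x s c → x :+ (s :- (con 1ℚ :+ con 1ℚ) :* c) := (x :+ s) :- (con 1ℚ :+ con 1ℚ) :* c)
                     refl (1ℚ * co α k) s sᶜ ⟩
        (1ℚ * co α k + s) - toℚ (+ 2) * sᶜ
          ≡⟨ cong (λ ys → (1ℚ * co α k + s) - toℚ (+ 2) * rootSum R S ys k)
                  (sym (List.filter-reject (compact? R S) ¬c)) ⟩
        (1ℚ * co α k + s) - toℚ (+ 2) * rootSum R S (filter (compact? R S) (α ∷ xs)) k ∎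

  φ-decomposition : ∀ k → φ R S k ≡ - toℚ (+ 2) * rootSum R S (Δ₊ R S) k
                                   + toℚ (+ 4) * rootSum R S (Δ₊ᶜ R S) k
                                   + - toℚ (+ 2) * rootSum R S (Δ₊ˢ R S) k
  φ-decomposition k = begin
    - (two * wsum R S (ε R S) (Δ₊ R S) k) - two * σˢ
      ≡⟨ cong (λ w → - (two * w) - two * σˢ) (wsum-ε (Δ₊ R S) k) ⟩
    - (two * (σ₊ - two * σᶜ)) - two * σˢ
      ≡⟨ solve 4 (λ t p c s → :- (t :* (p :- t :* c)) :- t :* s := (:- t) :* p :+ (t :* t) :* c :+ (:- t) :* s)
                 refl two σ₊ σᶜ σˢ ⟩
    - two * σ₊ + two * two * σᶜ + - two * σˢ
      ≡⟨ cong (λ f → - two * σ₊ + f * σᶜ + - two * σˢ) (sym (toℚ-homo-* (+ 2) (+ 2))) ⟩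
    - two * σ₊ + toℚ (+ 4) * σᶜ + - two * σˢ ∎
    where
      open ≡-Reasoning
      two σ₊ σᶜ σˢ : ℚ
      two = toℚ (+ 2)
      σ₊  = rootSum R S (Δ₊ R S) k
      σᶜ  = rootSum R S (Δ₊ᶜ R S) k
      σˢ  = rootSum R S (Δ₊ˢ R S) k

  module _ (i : Fin ℓ) where
    open SimpleReflection R i

    A·-⟨,γᵢ⟩ : ∀ c → A· R S c i ≡ toℚ (+ 2) * inv ‖γᵢ‖² * ⟨ c ,γᵢ⟩
    A·-⟨,γᵢ⟩ c = trans
      (∑-cong (λ k → trans (cong (λ g → toℚ (+ 2) * g * inv ‖γᵢ‖² * c k) (G-sym i k))
        (solve 4 (λ t g κ x → t :* g :* κ :* x := t :* κ :* (x :* g)) refl (toℚ (+ 2)) (G k i) (inv ‖γᵢ‖²) (c k))))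
      (∑-*ˡ (toℚ (+ 2) * inv ‖γᵢ‖²) (λ k → c k * G k i))

    ⟨rootSum,γᵢ⟩ : ∀ xs → ⟨ rootSum R S xs ,γᵢ⟩ ≡ sumℚ (map (λ α → ⟨ co α ,γᵢ⟩) xs)
    ⟨rootSum,γᵢ⟩ []       = trans (∑-*ˡ 0ℚ (λ a → G a i)) (ℚP.*-zeroˡ (∑ (λ a → G a i)))
    ⟨rootSum,γᵢ⟩ (α ∷ xs) = begin
      ⟨ (λ k → 1ℚ * co α k + rootSum R S xs k) ,γᵢ⟩
        ≡⟨ ⟨,γᵢ⟩-cong (λ k → cong (λ s → 1ℚ * co α k + s) (sym (ℚP.*-identityˡ (rootSum R S xs k)))) ⟩
      ⟨ (λ k → 1ℚ * co α k + 1ℚ * rootSum R S xs k) ,γᵢ⟩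
        ≡⟨ ⟨,γᵢ⟩-linear 1ℚ 1ℚ (co α) (rootSum R S xs) ⟩
      1ℚ * ⟨ co α ,γᵢ⟩ + 1ℚ * ⟨ rootSum R S xs ,γᵢ⟩
        ≡⟨ cong₂ _+_ (ℚP.*-identityˡ ⟨ co α ,γᵢ⟩)
                     (trans (ℚP.*-identityˡ ⟨ rootSum R S xs ,γᵢ⟩) (⟨rootSum,γᵢ⟩ xs)) ⟩
      ⟨ co α ,γᵢ⟩ + sumℚ (map (λ α → ⟨ co α ,γᵢ⟩) xs) ∎
      where open ≡-Reasoning

    _≟ᵥ_ : DecidableEquality (Vec ℤ ℓ)
    _≟ᵥ_ = ≡-dec ℤ._≟_

    nonNegative? : (α : Vec ℤ ℓ) → Dec (NonNegative α)
    nonNegative? = VAll.all? (λ x → + 0 ℤ.≤? x)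

    ≢eᵢ? : (α : Vec ℤ ℓ) → Dec (α ≢ eᵢ)
    ≢eᵢ? α = ¬? (α ≟ᵥ eᵢ)

    Δ₊-unique : Unique (Δ₊ R S)
    Δ₊-unique = Unique.filter⁺ nonNegative? roots-unique

    Δ₊∖γᵢ : List (Vec ℤ ℓ)
    Δ₊∖γᵢ = filter ≢eᵢ? (Δ₊ R S)

    root-Δ₊∖γᵢ : ∀ {α} → α ∈ Δ₊∖γᵢ → α ∈ roots
    root-Δ₊∖γᵢ α∈ = proj₁ (∈-filter⁻ nonNegative? (proj₁ (∈-filter⁻ ≢eᵢ? α∈)))

    reflect-Δ₊∖γᵢ : ∀ {α} → α ∈ Δ₊∖γᵢ → reflect α ∈ Δ₊∖γᵢ
    reflect-Δ₊∖γᵢ α∈ with ∈-filter⁻ ≢eᵢ? α∈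
    ... | α∈Δ₊ , α≢eᵢ with ∈-filter⁻ nonNegative? α∈Δ₊
    ...   | α∈R , α≥0 = ∈-filter⁺ ≢eᵢ?
      (∈-filter⁺ nonNegative? (reflect-root α∈R) (reflect-nonNegative α∈R α≥0 α≢eᵢ))
      (reflect-≢eᵢ α∈R α≥0)

    ⟨Δ₊∖γᵢ,γᵢ⟩ : sumℚ (map (λ α → ⟨ co α ,γᵢ⟩) Δ₊∖γᵢ) ≡ 0ℚ
    ⟨Δ₊∖γᵢ,γᵢ⟩ = sumℚ-antiInvariant≡0 (λ α → ⟨ co α ,γᵢ⟩) reflect (Unique.filter⁺ ≢eᵢ? Δ₊-unique)
      reflect-Δ₊∖γᵢ
      (λ α∈ → reflect-involutive (root-Δ₊∖γᵢ α∈))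
      (λ α∈ → ⟨reflect,γᵢ⟩ (root-Δ₊∖γᵢ α∈))

    ⟨2ρ,γᵢ⟩ : ⟨ rootSum R S (Δ₊ R S) ,γᵢ⟩ ≡ ‖γᵢ‖²
    ⟨2ρ,γᵢ⟩ = begin
      ⟨ rootSum R S (Δ₊ R S) ,γᵢ⟩
        ≡⟨ ⟨rootSum,γᵢ⟩ (Δ₊ R S) ⟩
      sumℚ (map (λ α → ⟨ co α ,γᵢ⟩) (Δ₊ R S))
        ≡⟨ sumℚ-remove _≟ᵥ_ (λ α → ⟨ co α ,γᵢ⟩) Δ₊-unique
             (∈-filter⁺ nonNegative? (simple∈ i) (unitVec-nonNegative i)) ⟩
      ⟨ co eᵢ ,γᵢ⟩ + sumℚ (map (λ α → ⟨ co α ,γᵢ⟩) Δ₊∖γᵢ)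
        ≡⟨ cong₂ _+_ ⟨eᵢ,γᵢ⟩ ⟨Δ₊∖γᵢ,γᵢ⟩ ⟩
      ‖γᵢ‖² + 0ℚ
        ≡⟨ ℚP.+-identityʳ ‖γᵢ‖² ⟩
      ‖γᵢ‖² ∎
      where open ≡-Reasoning

    A·-2ρ : A· R S (rootSum R S (Δ₊ R S)) i ≡ toℚ (+ 2)
    A·-2ρ = trans (A·-⟨,γᵢ⟩ (rootSum R S (Δ₊ R S)))
                  (trans (cong (toℚ (+ 2) * inv ‖γᵢ‖² *_) ⟨2ρ,γᵢ⟩) (*-inv-*-‖γᵢ‖² (toℚ (+ 2))))

open import Data.Fin.Subset using (_∈_)

mainTheorem1 : ∀ (ℓ : ℕ) (R : RootSystem ℓ) (S : Subset ℓ) (i : Fin ℓ) → i ∈ S →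
    ξ R S i ≡ toℚ -[1+ 3 ] + toℚ (+ 4) * A· R S (rootSum R S (Δ₊ᶜ R S)) i
    - toℚ (+ 2) * A· R S (rootSum R S (Δ₊ˢ R S)) i
mainTheorem1 ℓ R S i _ = begin
  A· R S (φ R S) i
    ≡⟨ A·-cong R S (φ-decomposition R S) i ⟩
  A· R S (λ k → - two * Σ₊ k + toℚ (+ 4) * Σᶜ k + - two * Σˢ k) i
    ≡⟨ A·-linear₃ R S (- two) (toℚ (+ 4)) (- two) Σ₊ Σᶜ Σˢ i ⟩
  - two * A· R S Σ₊ i + toℚ (+ 4) * A· R S Σᶜ i + - two * A· R S Σˢ i
    ≡⟨ cong (λ a → - two * a + toℚ (+ 4) * A· R S Σᶜ i + - two * A· R S Σˢ i) (A·-2ρ R S i) ⟩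
  - two * two + toℚ (+ 4) * A· R S Σᶜ i + - two * A· R S Σˢ i
    ≡⟨ solve 4 (λ t f c s → (:- t) :* t :+ f :* c :+ (:- t) :* s := (:- t) :* t :+ f :* c :- t :* s)
               refl two (toℚ (+ 4)) (A· R S Σᶜ i) (A· R S Σˢ i) ⟩
  toℚ -[1+ 3 ] + toℚ (+ 4) * A· R S Σᶜ i - two * A· R S Σˢ i ∎
  where
    open ≡-Reasoning
    two : ℚ
    two = toℚ (+ 2)
    Σ₊ Σᶜ Σˢ : Fin ℓ → ℚ
    Σ₊ = rootSum R S (Δ₊ R S)
    Σᶜ = rootSum R S (Δ₊ᶜ R S)
    Σˢ = rootSum R S (Δ₊ˢ R S)
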